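{- Let $A$ be a non-empty finite alphabet. In the set of uniquely decipherable codes over $A$, partially ordered by refinement $\leq$, every infinite chain consisting of uniquely decipherable codes all having the same Kraft sum has order type $\omega^{\ast}$, i.e. is order-isomorphic to the negative integers.
   Context: Let $r = |A|$. $A^{\ast}$ denotes the set of finite strings (words) over $A$, and $A^{\ast\ast}$ the set of finite strings of words; $con: A^{\ast\ast}\to A^{\ast}$ is the concatenation map. A code is a finite subset $C \subseteq A^{\ast}$ not containing the empty string; $C^{\ast}\subseteq A^{\ast\ast}$ is the set of finite strings of words from $C$. A code $C$ is uniquely decipherable (UD) if $con$ is injective on $C^{\ast}$. For codes $C, D$, write $C \leq D$ ($D$ is finer than $C$) if every word of $C$ is a concatenation of words of $D$; this is a partial order on UD codes. A chain is a totally ordered subset under $\leq$. The Kraft sum of a code $C$ is $K(C) = \sum_{\mathbf{x}\in C} r^{ -len(\mathbf{x})}$, where $len$ is word length. -}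

module Defs where

open import Data.Nat using (ℕ; suc; _^_; _≤_)
open import Data.Nat.Properties using (m^n≢0)
open import Data.Fin using (Fin)
open import Data.List using (List; []; concat; length)
open import Data.List.Membership.Propositional using (_∈_)
open import Data.List.Relation.Unary.All using (All)
open import Data.List.Relation.Unary.Any using (Any)
open import Data.List.Relation.Unary.Unique.Propositional using (Unique)
open import Data.Integer using (+_)
open import Data.Rational using (ℚ; _/_; 0ℚ; _+_)
open import Data.Product using (Σ; ∃; _×_)
open import Data.Sum using (_⊎_)
open import Function.Bundles using (_⇔_)
open import Relation.Nullary using (¬_)
open import Relation.Binary.PropositionalEquality using (_≡_)

-- The alphabet A = Fin r with r = suc k ≥ 1 (non-empty, finite).
-- Words over A.
Word : ℕ → Set
Word k = List (Fin (suc k))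

-- A finite set of words, represented by a list (read as the set of its entries).
Code : ℕ → Set
Code k = List (Word k)

IsCode : ∀ {k} → Code k → Set
IsCode C = ¬ ([] ∈ C) × Unique C

_≈C_ : ∀ {k} → Code k → Code k → Set
C ≈C D = ∀ w → (w ∈ C) ⇔ (w ∈ D)

UD : ∀ {k} → Code k → Set
UD {k} C = (xs ys : List (Word k)) → All (_∈ C) xs → All (_∈ C) ys →
           concat xs ≡ concat ys → xs ≡ ys

IsUDCode : ∀ {k} → Code k → Set
IsUDCode C = IsCode C × UD C

_≼_ : ∀ {k} → Code k → Code k → Set
_≼_ {k} C D = All (λ w → Σ (List (Word k)) λ ws → All (_∈ D) ws × concat ws ≡ w) C

invPow : ℕ → ℕ → ℚ
invPow k n = (+ 1) / (suc k ^ n)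
  where instance _ = m^n≢0 (suc k) n

kraft : ∀ {k} → Code k → ℚ
kraft [] = 0ℚ
kraft {k} (w Data.List.∷ C) = invPow k (length w) + kraft C

Infinite : ∀ {k} → (Code k → Set) → Set
Infinite {k} P = ¬ (Σ (List (Code k)) λ Ls → ∀ C → P C → Any (C ≈C_) Ls)

IsChain : ∀ {k} → (Code k → Set) → Set
IsChain P = ∀ C D → P C → P D → (C ≼ D) ⊎ (D ≼ C)

-- Order type ω* (negative integers ... < -3 < -2 < -1): there is an
-- enumeration f, n ↦ -(n+1), which is an order isomorphism onto P
-- (elements of P taken up to set equality).
HasOrderTypeOmegaStar : ∀ {k} → (Code k → Set) → Set
HasOrderTypeOmegaStar {k} P =
  Σ (ℕ → Code k) λ f →
    (∀ n → P (f n)) ×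
    (∀ m n → (m ≤ n) ⇔ (f n ≼ f m)) ×
    (∀ C → P C → ∃ λ n → C ≈C f n)

-- A finer UD code has at least the Kraft sum of a coarser one. Refining strings of n words of
-- C into words of D is injective (C is UD), and the refined strings have between n and nL
-- words, so K(C)^n ≤ (1 + nL) K(D)^n once K(D) ≤ 1; letting n grow gives K(C) ≤ K(D).
-- McMillan's inequality K(D) ≤ 1 is itself this comparison of D with the alphabet.
-- Consequently, if C ≤ D and K(C) = K(D), no word of D is longer than the longest word of C:
-- dropping such words would keep D finer than C but lower its Kraft sum. So every code of the
-- chain has only finitely many codes of the chain above it. An infinite chain with finite
-- upsets is exhausted by starting at its greatest element and repeatedly passing to the
-- greatest element not above the current one, which gives order type ω*.

module Submission where

open import Defs
open import Axiom.DoubleNegationElimination using (em⇒dne)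
open import Axiom.ExcludedMiddle using (ExcludedMiddle)
open import Data.Empty using (⊥-elim)
import Data.Fin as Fin
import Data.Fin.Properties as Finₚ
import Data.Integer as ℤ
import Data.Integer.Properties as ℤₚ
import Data.Integer.Tactic.RingSolver as ℤ-Solver
open import Data.List using (List; []; _∷_; _++_; [_]; length; concat; concatMap; map; filter; cartesianProductWith; allFin; lookup)
open import Data.List.Membership.Propositional using (_∈_)
open import Data.List.Membership.Propositional.Properties using (∈-++⁺ˡ; ∈-++⁺ʳ; ∈-map⁺; ∈-map⁻; ∈-cartesianProductWith⁺; ∈-cartesianProductWith⁻; ∈-allFin; ∈-filter⁺; ∈-filter⁻)
import Data.List.Properties as Listₚ
open import Data.List.Relation.Unary.All as All using (All; []; _∷_)
import Data.List.Relation.Unary.All.Properties as AllP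
open import Data.List.Relation.Unary.Any as Any using (Any; here; there; _─_)
open import Data.List.Relation.Unary.Any.Properties using (lookup-index)
open import Data.List.Relation.Unary.Unique.Propositional using (Unique; []; _∷_)
import Data.List.Relation.Unary.Unique.Propositional.Properties as UniqueP
open import Data.Nat using (NonZero; ℕ; zero; suc; _+_; _*_; _∸_; _^_; _≤_; _<_; z≤n; s≤s; _≤?_; _⊔_)
import Data.Nat.Properties as ℕₚ
open import Algebra.Properties.CommutativeSemigroup ℕₚ.+-commutativeSemigroup using () renaming (x∙yz≈y∙xz to +-comm-middle)
open import Algebra.Properties.CommutativeSemigroup ℕₚ.*-commutativeSemigroup using (x∙yz≈y∙xz)
open import Data.Nat.Tactic.RingSolver using (solve-∀)
open import Data.Product using (∃; _×_; _,_; proj₁; proj₂)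
open import Data.Rational as ℚ using (ℚ)
import Data.Rational.Properties as ℚₚ
open import Data.Rational.Unnormalised as ℚᵘ using (mkℚᵘ; *≡*)
import Data.Rational.Unnormalised.Properties as ℚᵘₚ
open import Data.Sum using (_⊎_; inj₁; inj₂)
open import Data.Unit using (⊤; tt)
open import Function using (_∘_)
open import Function.Bundles using (_⇔_; Equivalence; mk⇔)
open import Function.Properties.Equivalence using (⇔-isEquivalence)
open import Level using (0ℓ)
open import Relation.Binary.Bundles using (Preorder)
open import Relation.Binary.PropositionalEquality using (_≡_; _≢_; refl; sym; trans; cong; cong₂; subst; module ≡-Reasoning)
open import Relation.Binary.Structures using (IsEquivalence)
open import Relation.Nullary using (¬_; yes; no; contradiction)
open import Relation.Unary using (Decidable)

private
  variable
    A B : Set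

∑ : (A → ℕ) → List A → ℕ
∑ g [] = 0
∑ g (x ∷ xs) = g x + ∑ g xs

∑-++ : ∀ (g : A → ℕ) xs ys → ∑ g (xs ++ ys) ≡ ∑ g xs + ∑ g ys
∑-++ g [] ys = refl
∑-++ g (x ∷ xs) ys = trans (cong (g x +_) (∑-++ g xs ys)) (sym (ℕₚ.+-assoc (g x) _ _))

∑-cong : ∀ {g h : A → ℕ} xs → (∀ {x} → x ∈ xs → g x ≡ h x) → ∑ g xs ≡ ∑ h xs
∑-cong [] g≡h = refl
∑-cong (x ∷ xs) g≡h = cong₂ _+_ (g≡h (here refl)) (∑-cong xs (g≡h ∘ there))

∑-*ˡ : ∀ (g : A → ℕ) c xs → ∑ (λ x → c * g x) xs ≡ c * ∑ g xs
∑-*ˡ g c [] = sym (ℕₚ.*-zeroʳ c)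
∑-*ˡ g c (x ∷ xs) = trans (cong (c * g x +_) (∑-*ˡ g c xs)) (sym (ℕₚ.*-distribˡ-+ c (g x) _))

∑-*ʳ : ∀ (g : A → ℕ) c xs → ∑ (λ x → g x * c) xs ≡ ∑ g xs * c
∑-*ʳ g c [] = refl
∑-*ʳ g c (x ∷ xs) = trans (cong (g x * c +_) (∑-*ʳ g c xs)) (sym (ℕₚ.*-distribʳ-+ c (g x) _))

∑-const : ∀ c (xs : List A) → ∑ (λ _ → c) xs ≡ length xs * c
∑-const c [] = refl
∑-const c (x ∷ xs) = cong (c +_) (∑-const c xs)

∑-map : ∀ (g : B → ℕ) (f : A → B) xs → ∑ g (map f xs) ≡ ∑ (g ∘ f) xs
∑-map g f [] = refl
∑-map g f (x ∷ xs) = cong (g (f x) +_) (∑-map g f xs)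

∑-─ : ∀ (g : A → ℕ) {x} ys (x∈ys : x ∈ ys) → ∑ g ys ≡ g x + ∑ g (ys ─ x∈ys)
∑-─ g (y ∷ ys) (here refl) = refl
∑-─ g {x} (y ∷ ys) (there x∈ys) =
  trans (cong (g y +_) (∑-─ g ys x∈ys)) (+-comm-middle (g y) (g x) _)

∈-─ : ∀ {x y : A} ys (x∈ys : x ∈ ys) → y ∈ ys → x ≢ y → y ∈ (ys ─ x∈ys)
∈-─ (z ∷ zs) (here refl) (here refl) x≢y = ⊥-elim (x≢y refl)
∈-─ (z ∷ zs) (here refl) (there y∈zs) x≢y = y∈zs
∈-─ (z ∷ zs) (there x∈zs) (here refl) x≢y = here refl
∈-─ (z ∷ zs) (there x∈zs) (there y∈zs) x≢y = there (∈-─ zs x∈zs y∈zs x≢y)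

∑-mono-⊆ : ∀ (g : A → ℕ) {xs ys} → Unique xs → All (_∈ ys) xs → ∑ g xs ≤ ∑ g ys
∑-mono-⊆ g [] [] = z≤n
∑-mono-⊆ g {x ∷ xs} {ys} (x∉xs ∷ xs!) (x∈ys ∷ xs⊆ys) = begin
  g x + ∑ g xs             ≤⟨ ℕₚ.+-monoʳ-≤ (g x) (∑-mono-⊆ g xs! xs⊆ys─x) ⟩
  g x + ∑ g (ys ─ x∈ys)    ≡⟨ sym (∑-─ g ys x∈ys) ⟩
  ∑ g ys                   ∎
  where
  open ℕₚ.≤-Reasoning
  xs⊆ys─x : All (_∈ (ys ─ x∈ys)) xs
  xs⊆ys─x = All.zipWith (λ (x≢z , z∈ys) → ∈-─ ys x∈ys z∈ys x≢z) (x∉xs , xs⊆ys)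

map⁺-injectiveOn : ∀ (f : A → B) {xs} →
                   (∀ {x y} → x ∈ xs → y ∈ xs → f x ≡ f y → x ≡ y) →
                   Unique xs → Unique (map f xs)
map⁺-injectiveOn f inj [] = []
map⁺-injectiveOn f inj (x∉xs ∷ xs!) =
  AllP.map⁺ (All.tabulate λ z∈xs fx≡fz → All.lookup x∉xs z∈xs (inj (here refl) (there z∈xs) fx≡fz))
  ∷ map⁺-injectiveOn f (λ x∈ y∈ → inj (there x∈) (there y∈)) xs!

∑-≤-injection : ∀ (g : B → ℕ) (f : A → B) {xs ys} → Unique xs →
                (∀ {x y} → x ∈ xs → y ∈ xs → f x ≡ f y → x ≡ y) →
                (∀ {x} → x ∈ xs → f x ∈ ys) →
                ∑ (g ∘ f) xs ≤ ∑ g ys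
∑-≤-injection g f {xs} {ys} xs! inj f[xs]⊆ys = begin
  ∑ (g ∘ f) xs   ≡⟨ sym (∑-map g f xs) ⟩
  ∑ g (map f xs) ≤⟨ ∑-mono-⊆ g (map⁺-injectiveOn f inj xs!) (AllP.map⁺ (All.tabulate f[xs]⊆ys)) ⟩
  ∑ g ys         ∎
  where open ℕₚ.≤-Reasoning

∑-filter-≤ : ∀ (g : A → ℕ) {P : A → Set} (P? : Decidable P) xs → ∑ g (filter P? xs) ≤ ∑ g xs
∑-filter-≤ g P? [] = z≤n
∑-filter-≤ g P? (x ∷ xs) with P? x
... | yes _ = ℕₚ.+-monoʳ-≤ (g x) (∑-filter-≤ g P? xs)
... | no _ = ℕₚ.≤-trans (∑-filter-≤ g P? xs) (ℕₚ.m≤n+m _ (g x))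

∑-filter-< : ∀ (g : A → ℕ) {P : A → Set} (P? : Decidable P) {x xs} →
             x ∈ xs → ¬ P x → 0 < g x → ∑ g (filter P? xs) < ∑ g xs
∑-filter-< g P? {xs = y ∷ ys} (here refl) ¬Py 0<gy
  rewrite Listₚ.filter-reject P? {y} {ys} ¬Py = ℕₚ.<-≤-trans (ℕₚ.m<n+m _ 0<gy) (ℕₚ.+-monoʳ-≤ (g y) (∑-filter-≤ g P? ys))
∑-filter-< g P? {xs = y ∷ ys} (there x∈ys) ¬Px 0<gx with P? y
... | yes _ = ℕₚ.+-monoʳ-< (g y) (∑-filter-< g P? x∈ys ¬Px 0<gx)
... | no _ = ℕₚ.<-≤-trans (∑-filter-< g P? x∈ys ¬Px 0<gx) (ℕₚ.m≤n+m _ (g y))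

∑-cartesianProductWith : ∀ {C : Set} (g : C → ℕ) (f : A → B → C) xs ys →
                         ∑ g (cartesianProductWith f xs ys) ≡ ∑ (λ x → ∑ (g ∘ f x) ys) xs
∑-cartesianProductWith g f [] ys = refl
∑-cartesianProductWith g f (x ∷ xs) ys =
  trans (∑-++ g (map (f x) ys) _) (cong₂ _+_ (∑-map g (f x) ys) (∑-cartesianProductWith g f xs ys))

length≤length-concat : ∀ (xss : List (List A)) → All (_≢ []) xss → length xss ≤ length (concat xss)
length≤length-concat [] [] = z≤n
length≤length-concat ([] ∷ xss) ([]≢[] ∷ _) = ⊥-elim ([]≢[] refl)
length≤length-concat ((x ∷ xs) ∷ xss) (_ ∷ xss≢[]) = s≤s (begin
  length xss                       ≤⟨ length≤length-concat xss xss≢[] ⟩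
  length (concat xss)              ≤⟨ ℕₚ.m≤n+m _ (length xs) ⟩
  length xs + length (concat xss)  ≡⟨ Listₚ.length-++ xs ⟨
  length (xs ++ concat xss)        ∎)
  where open ℕₚ.≤-Reasoning

length-∈-concat : ∀ {xs : List A} {xss} → xs ∈ xss → length xs ≤ length (concat xss)
length-∈-concat {xs = xs} {xss = xs ∷ xss} (here refl) = begin
  length xs                        ≤⟨ ℕₚ.m≤m+n (length xs) _ ⟩
  length xs + length (concat xss)  ≡⟨ Listₚ.length-++ xs ⟨
  length (xs ++ concat xss)        ∎
  where open ℕₚ.≤-Reasoning
length-∈-concat {xs = xs} {xss = ys ∷ xss} (there xs∈xss) = begin
  length xs                        ≤⟨ length-∈-concat xs∈xss ⟩
  length (concat xss)              ≤⟨ ℕₚ.m≤n+m _ (length ys) ⟩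
  length ys + length (concat xss)  ≡⟨ Listₚ.length-++ ys ⟨
  length (ys ++ concat xss)        ∎
  where open ℕₚ.≤-Reasoning

length-concat≤ : ∀ L (xss : List (List A)) → All (λ xs → length xs ≤ L) xss →
                 length (concat xss) ≤ length xss * L
length-concat≤ L [] [] = z≤n
length-concat≤ L (xs ∷ xss) (xs≤L ∷ xss≤L) = ℕₚ.≤-trans (ℕₚ.≤-reflexive (Listₚ.length-++ xs))
  (ℕₚ.+-mono-≤ xs≤L (length-concat≤ L xss xss≤L))

tuples : ℕ → List A → List (List A)
tuples zero X = [ [] ]
tuples (suc n) X = cartesianProductWith _∷_ X (tuples n X)

∈-tuples⁻ : ∀ n X {t : List A} → t ∈ tuples n X → length t ≡ n × All (_∈ X) t
∈-tuples⁻ zero X (here refl) = refl , []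
∈-tuples⁻ (suc n) X t∈ with ∈-cartesianProductWith⁻ _∷_ X (tuples n X) t∈
... | x , t , x∈X , t∈′ , refl = let |t|≡n , t⊆X = ∈-tuples⁻ n X t∈′ in cong suc |t|≡n , x∈X ∷ t⊆X

∈-tuples⁺ : ∀ X {t : List A} → All (_∈ X) t → t ∈ tuples (length t) X
∈-tuples⁺ X [] = here refl
∈-tuples⁺ X (x∈X ∷ t⊆X) = ∈-cartesianProductWith⁺ _∷_ x∈X (∈-tuples⁺ X t⊆X)

tuples-unique : ∀ n {X : List A} → Unique X → Unique (tuples n X)
tuples-unique zero X! = [] ∷ []
tuples-unique (suc n) X! = UniqueP.cartesianProductWith⁺ _∷_ (λ { refl → refl , refl }) X! (tuples-unique n X!)

tuplesBetween : ℕ → ℕ → List A → List (List A)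
tuplesBetween a zero X = []
tuplesBetween a (suc c) X = tuples a X ++ tuplesBetween (suc a) c X

∈-tuplesBetween⁺ : ∀ a c X {t : List A} → a ≤ length t → length t < a + c → All (_∈ X) t →
                   t ∈ tuplesBetween a c X
∈-tuplesBetween⁺ a zero X a≤|t| |t|<a+0 _ =
  ⊥-elim (ℕₚ.<⇒≱ |t|<a+0 (ℕₚ.≤-trans (ℕₚ.≤-reflexive (ℕₚ.+-identityʳ a)) a≤|t|))
∈-tuplesBetween⁺ a (suc c) X {t} a≤|t| |t|<a+1+c t⊆X with ℕₚ.m≤n⇒m<n∨m≡n a≤|t|
... | inj₂ refl = ∈-++⁺ˡ (∈-tuples⁺ X t⊆X)
... | inj₁ a<|t| = ∈-++⁺ʳ (tuples a X)
  (∈-tuplesBetween⁺ (suc a) c X a<|t| (subst (length t <_) (ℕₚ.+-suc a c) |t|<a+1+c) t⊆X)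

sublists : List A → List (List A)
sublists [] = [ [] ]
sublists (x ∷ xs) = map (x ∷_) (sublists xs) ++ sublists xs

filter∈sublists : ∀ {P : A → Set} (P? : Decidable P) xs → filter P? xs ∈ sublists xs
filter∈sublists P? [] = here refl
filter∈sublists P? (x ∷ xs) with P? x
... | yes _ = ∈-++⁺ˡ (∈-map⁺ (x ∷_) (filter∈sublists P? xs))
... | no _ = ∈-++⁺ʳ (map (x ∷_) (sublists xs)) (filter∈sublists P? xs)

m∸[n+o]≡[p∸n]+[m∸p∸o] : ∀ {m n o p} → n ≤ p → p ≤ m → o ≤ m ∸ p →
                         m ∸ (n + o) ≡ (p ∸ n) + (m ∸ p ∸ o)
m∸[n+o]≡[p∸n]+[m∸p∸o] {m} {n} {o} {p} n≤p p≤m o≤m∸p = begin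
  m ∸ (n + o)               ≡⟨ ℕₚ.∸-+-assoc m n o ⟨
  m ∸ n ∸ o                 ≡⟨ cong (λ x → x ∸ n ∸ o) (ℕₚ.m∸n+n≡m p≤m) ⟨
  m ∸ p + p ∸ n ∸ o         ≡⟨ cong (_∸ o) (ℕₚ.+-∸-assoc (m ∸ p) n≤p) ⟩
  m ∸ p + (p ∸ n) ∸ o       ≡⟨ cong (_∸ o) (ℕₚ.+-comm (m ∸ p) (p ∸ n)) ⟩
  (p ∸ n) + (m ∸ p) ∸ o     ≡⟨ ℕₚ.+-∸-assoc (p ∸ n) o≤m∸p ⟩
  (p ∸ n) + (m ∸ p ∸ o)     ∎
  where open ≡-Reasoning

m∸[n+o]+n≡m∸o : ∀ {m n o} → n + o ≤ m → m ∸ (n + o) + n ≡ m ∸ o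
m∸[n+o]+n≡m∸o {m} {n} {o} n+o≤m = begin
  m ∸ (n + o) + n  ≡⟨ cong (λ x → m ∸ x + n) (ℕₚ.+-comm n o) ⟩
  m ∸ (o + n) + n  ≡⟨ cong (_+ n) (ℕₚ.∸-+-assoc m o n) ⟨
  m ∸ o ∸ n + n    ≡⟨ ℕₚ.m∸n+n≡m (ℕₚ.m+n≤o⇒m≤o∸n n n+o≤m) ⟩
  m ∸ o            ∎
  where open ≡-Reasoning

[m+n]*m^n≤m*[1+m]^n : ∀ m n → (m + n) * m ^ n ≤ m * suc m ^ n
[m+n]*m^n≤m*[1+m]^n m zero = ℕₚ.≤-reflexive (cong (_* 1) (ℕₚ.+-identityʳ m))
[m+n]*m^n≤m*[1+m]^n m (suc n) = begin
  (m + suc n) * (m * m ^ n)               ≡⟨ expand m n (m ^ n) ⟩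
  (m + n) * m ^ n * m + m * m ^ n         ≤⟨ ℕₚ.+-monoʳ-≤ _ (ℕₚ.*-monoˡ-≤ (m ^ n) (ℕₚ.m≤m+n m n)) ⟩
  (m + n) * m ^ n * m + (m + n) * m ^ n   ≡⟨ trans (ℕₚ.*-suc y m) (ℕₚ.+-comm y (y * m)) ⟨
  (m + n) * m ^ n * suc m                 ≤⟨ ℕₚ.*-monoˡ-≤ (suc m) ([m+n]*m^n≤m*[1+m]^n m n) ⟩
  m * suc m ^ n * suc m                   ≡⟨ reassoc m (suc m ^ n) ⟩
  m * (suc m * suc m ^ n)                 ∎
  where
  open ℕₚ.≤-Reasoning
  y = (m + n) * m ^ n
  expand : ∀ m n x → (m + suc n) * (m * x) ≡ (m + n) * x * m + m * x
  expand = solve-∀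
  reassoc : ∀ m x → m * x * suc m ≡ m * (suc m * x)
  reassoc = solve-∀

-- If B < A then A^n outgrows (1 + nL) B^n; squaring Bernoulli's inequality exhibits this
-- at the exponent 2n with n = 1 + 2B²(L + 1).
≤-if-^≤linear*^ : ∀ A B L → (∀ n → A ^ n ≤ suc (n * L) * B ^ n) → A ≤ B
≤-if-^≤linear*^ A zero L bound = ℕₚ.≤-trans (ℕₚ.≤-reflexive (sym (ℕₚ.*-identityʳ A)))
  (ℕₚ.≤-trans (bound 1) (ℕₚ.≤-reflexive (ℕₚ.*-zeroʳ (suc (1 * L)))))
≤-if-^≤linear*^ A B@(suc _) L bound with A ≤? B
... | yes A≤B = A≤B
... | no A≰B = contradiction squares-bounded (ℕₚ.<⇒≱ n²-large)
  where
  q = B * B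
  n = suc (2 * q * (L + 1))
  instance _ = ℕₚ.m^n≢0 B (n + n)

  n²-large : q * suc ((n + n) * L) < n * n
  n²-large = subst (q * suc ((n + n) * L) <_) (sym (expand q L))
    (ℕₚ.m<m+n _ (ℕₚ.<-≤-trans (s≤s z≤n) (ℕₚ.m≤n+m n _)))
    where
    expand : ∀ q L → let n = suc (2 * q * (L + 1)) in
             n * n ≡ q * suc ((n + n) * L) + (q * (2 * (2 * q * (L + 1)) + 1) + n)
    expand = solve-∀

  squares-bounded : n * n ≤ q * suc ((n + n) * L)
  squares-bounded = ℕₚ.≤-trans (ℕₚ.*-mono-≤ (ℕₚ.m≤n+m n B) (ℕₚ.m≤n+m n B))
    (ℕₚ.*-cancelʳ-≤ _ _ (B ^ (n + n)) (begin
      (B + n) * (B + n) * B ^ (n + n)         ≡⟨ cong ((B + n) * (B + n) *_) (ℕₚ.^-distribˡ-+-* B n n) ⟩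
      (B + n) * (B + n) * (B ^ n * B ^ n)     ≡⟨ interchange (B + n) (B ^ n) ⟩
      (B + n) * B ^ n * ((B + n) * B ^ n)     ≤⟨ ℕₚ.*-mono-≤ bernoulli bernoulli ⟩
      B * suc B ^ n * (B * suc B ^ n)         ≡⟨ interchange B (suc B ^ n) ⟨
      q * (suc B ^ n * suc B ^ n)             ≡⟨ cong (q *_) (ℕₚ.^-distribˡ-+-* (suc B) n n) ⟨
      q * suc B ^ (n + n)                     ≤⟨ ℕₚ.*-monoʳ-≤ q (ℕₚ.^-monoˡ-≤ (n + n) (ℕₚ.≰⇒> A≰B)) ⟩
      q * A ^ (n + n)                         ≤⟨ ℕₚ.*-monoʳ-≤ q (bound (n + n)) ⟩
      q * (suc ((n + n) * L) * B ^ (n + n))   ≡⟨ ℕₚ.*-assoc q (suc ((n + n) * L)) (B ^ (n + n)) ⟨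
      q * suc ((n + n) * L) * B ^ (n + n)     ∎))
    where
    open ℕₚ.≤-Reasoning
    bernoulli = [m+n]*m^n≤m*[1+m]^n B n
    interchange : ∀ x y → x * x * (y * y) ≡ x * y * (x * y)
    interchange = solve-∀

toℚᵘ-/ : ∀ a d .{{_ : NonZero d}} → ℚ.toℚᵘ (ℤ.+ a ℚ./ d) ℚᵘ.≃ ℤ.+ a ℚᵘ./ d
toℚᵘ-/ a (suc d) = ℚₚ.toℚᵘ-fromℚᵘ (mkℚᵘ (ℤ.+ a) d)

/-cross : ∀ a b d e .{{_ : NonZero d}} .{{_ : NonZero e}} → a * e ≡ b * d → ℤ.+ a ℚ./ d ≡ ℤ.+ b ℚ./ e
/-cross a b (suc d) (suc e) ae≡bd = ℚₚ.toℚᵘ-injective (ℚᵘₚ.≃-trans (toℚᵘ-/ a (suc d))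
  (ℚᵘₚ.≃-trans (*≡* (trans (sym (ℤₚ.pos-* a (suc e))) (trans (cong ℤ.+_ ae≡bd) (ℤₚ.pos-* b (suc d)))))
               (ℚᵘₚ.≃-sym (toℚᵘ-/ b (suc e)))))

/-injectiveˡ : ∀ {a b} d .{{_ : NonZero d}} → ℤ.+ a ℚ./ d ≡ ℤ.+ b ℚ./ d → a ≡ b
/-injectiveˡ {a} {b} (suc d) eq = ℤₚ.+-injective (ℤₚ.*-cancelʳ-≡ (ℤ.+ a) (ℤ.+ b) (ℤ.+ suc d)
  (ℚᵘₚ.drop-*≡* (ℚₚ./-injective-≃ (mkℚᵘ (ℤ.+ a) d) (mkℚᵘ (ℤ.+ b) d) eq)))

+-/ : ∀ a b d .{{_ : NonZero d}} → ℤ.+ a ℚ./ d ℚ.+ ℤ.+ b ℚ./ d ≡ ℤ.+ (a + b) ℚ./ d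
+-/ a b (suc d) = ℚₚ.toℚᵘ-injective (ℚᵘₚ.≃-trans (ℚₚ.toℚᵘ-homo-+ (ℤ.+ a ℚ./ suc d) (ℤ.+ b ℚ./ suc d))
  (ℚᵘₚ.≃-trans (ℚᵘₚ.+-cong (toℚᵘ-/ a (suc d)) (toℚᵘ-/ b (suc d)))
  (ℚᵘₚ.≃-trans (*≡* (trans (distrib (ℤ.+ a) (ℤ.+ b) (ℤ.+ suc d))
                           (cong₂ ℤ._*_ (sym (ℤₚ.pos-+ a b)) (sym (ℤₚ.pos-* (suc d) (suc d))))))
               (ℚᵘₚ.≃-sym (toℚᵘ-/ (a + b) (suc d))))))
  where
  distrib : ∀ x y z → (x ℤ.* z ℤ.+ y ℤ.* z) ℤ.* z ≡ (x ℤ.+ y) ℤ.* (z ℤ.* z)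
  distrib = ℤ-Solver.solve-∀

-- The refinement preorder

module _ {k : ℕ} where

  ≈C-isEquivalence : IsEquivalence (_≈C_ {k})
  ≈C-isEquivalence = record
    { refl = λ w → ⇔.refl
    ; sym = λ C≈D w → ⇔.sym (C≈D w)
    ; trans = λ C≈D D≈E w → ⇔.trans (C≈D w) (D≈E w)
    }
    where module ⇔ = IsEquivalence (⇔-isEquivalence {ℓ = 0ℓ})

  Factorisation : Code k → Word k → Set
  Factorisation D w = ∃ λ ws → All (_∈ D) ws × concat ws ≡ w

  concat-factorisation : ∀ {D ws} → All (Factorisation D) ws → Factorisation D (concat ws)
  concat-factorisation [] = [] , [] , refl
  concat-factorisation ((vs , vs∈D , vs≡w) ∷ fs) =
    let vs′ , vs′∈D , vs′≡ws = concat-factorisation fs in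
    vs ++ vs′ , AllP.++⁺ vs∈D vs′∈D , trans (sym (Listₚ.concat-++ vs vs′)) (cong₂ _++_ vs≡w vs′≡ws)

  length≤length-concat-factorisation : ∀ {D ws} → All (_≢ []) ws → (fs : All (Factorisation D) ws) →
                                       length ws ≤ length (proj₁ (concat-factorisation fs))
  length≤length-concat-factorisation [] [] = z≤n
  length≤length-concat-factorisation (w≢[] ∷ _) (([] , _ , []≡w) ∷ _) = ⊥-elim (w≢[] (sym []≡w))
  length≤length-concat-factorisation (_ ∷ ws≢[]) ((v ∷ vs , _ , _) ∷ fs) =
    s≤s (ℕₚ.≤-trans (length≤length-concat-factorisation ws≢[] fs)
                    (ℕₚ.≤-trans (ℕₚ.m≤n+m _ (length vs)) (ℕₚ.≤-reflexive (sym (Listₚ.length-++ vs)))))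

  ⊆⇒≼ : ∀ {C D : Code k} → (∀ {w} → w ∈ C → w ∈ D) → C ≼ D
  ⊆⇒≼ C⊆D = All.tabulate λ {w} w∈C → [ w ] , C⊆D w∈C ∷ [] , Listₚ.++-identityʳ w

  ≼-trans : ∀ {C D E : Code k} → C ≼ D → D ≼ E → C ≼ E
  ≼-trans C≼D D≼E = All.map (λ (ws , ws∈D , ws≡w) →
    let vs , vs∈E , vs≡ws = concat-factorisation (All.map (All.lookup D≼E) ws∈D) in
    vs , vs∈E , trans vs≡ws ws≡w) C≼D

  ≼-preorder : Preorder 0ℓ 0ℓ 0ℓ
  ≼-preorder = record
    { Carrier = Code k
    ; _≈_ = _≈C_
    ; _≲_ = _≼_
    ; isPreorder = record
      { isEquivalence = ≈C-isEquivalence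
      ; reflexive = λ C≈D → ⊆⇒≼ (λ {w} → Equivalence.to (C≈D w))
      ; trans = ≼-trans
      }
    }

  ∉⇒All≢[] : ∀ {D : Code k} → ¬ ([] ∈ D) → ∀ {ws} → All (_∈ D) ws → All (_≢ []) ws
  ∉⇒All≢[] []∉D = All.map λ w∈D w≡[] → []∉D (subst (_∈ _) w≡[] w∈D)

  -- Factorising w ∈ C over D and back over C must give the trivial C-factorisation [ w ].
  ≼-antisym-⊆ : ∀ {C D : Code k} → IsUDCode C → ¬ ([] ∈ D) → C ≼ D → D ≼ C → ∀ {w} → w ∈ C → w ∈ D
  ≼-antisym-⊆ {C} {D} (([]∉C , _) , C-ud) []∉D C≼D D≼C {w} w∈C
    with ws , ws∈D , ws≡w ← All.lookup C≼D w∈C = single ws ws∈D ws≡w length-ws≤1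
    where
    fs = All.map (All.lookup D≼C) ws∈D
    back-to-C : proj₁ (concat-factorisation fs) ≡ [ w ]
    back-to-C = C-ud _ _ (proj₁ (proj₂ (concat-factorisation fs))) (w∈C ∷ [])
      (trans (proj₂ (proj₂ (concat-factorisation fs))) (trans ws≡w (sym (Listₚ.++-identityʳ w))))
    length-ws≤1 : length ws ≤ 1
    length-ws≤1 = subst (λ vs → length ws ≤ length vs) back-to-C
                    (length≤length-concat-factorisation (∉⇒All≢[] []∉D ws∈D) fs)
    single : ∀ vs → All (_∈ D) vs → concat vs ≡ w → length vs ≤ 1 → w ∈ D
    single [] _ []≡w _ = ⊥-elim ([]∉C (subst (_∈ C) (sym []≡w) w∈C))
    single (v ∷ []) (v∈D ∷ []) v≡w _ = subst (_∈ D) (trans (sym (Listₚ.++-identityʳ v)) v≡w) v∈D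
    single (_ ∷ _ ∷ _) _ _ (s≤s ())

  ≼-antisym : ∀ {C D : Code k} → IsUDCode C → IsUDCode D → C ≼ D → D ≼ C → C ≈C D
  ≼-antisym C-ud D-ud C≼D D≼C w = mk⇔ (≼-antisym-⊆ C-ud (proj₁ (proj₁ D-ud)) C≼D D≼C)
                                       (≼-antisym-⊆ D-ud (proj₁ (proj₁ C-ud)) D≼C C≼D)

-- Kraft sums

module _ {k : ℕ} where

  open import Data.List.Membership.DecPropositional (Listₚ.≡-dec (Fin._≟_ {suc k})) using (_∈?_)

  LengthsAtMost : ℕ → Code k → Set
  LengthsAtMost L C = All (λ w → length w ≤ L) C

  maxLength : Code k → ℕ
  maxLength [] = 0
  maxLength (w ∷ C) = length w ⊔ maxLength C

  LengthsAtMost-maxLength : ∀ C → LengthsAtMost (maxLength C) C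
  LengthsAtMost-maxLength [] = []
  LengthsAtMost-maxLength (w ∷ C) = ℕₚ.m≤m⊔n (length w) (maxLength C)
    ∷ All.map (λ |v|≤ → ℕₚ.≤-trans |v|≤ (ℕₚ.m≤n⊔m (length w) (maxLength C))) (LengthsAtMost-maxLength C)

  LengthsAtMost-mono : ∀ {L L′} {C : Code k} → L ≤ L′ → LengthsAtMost L C → LengthsAtMost L′ C
  LengthsAtMost-mono L≤L′ = All.map (λ |w|≤L → ℕₚ.≤-trans |w|≤L L≤L′)

  -- r^L · K(C) for r = suc k, an integer when L bounds the word lengths of C.
  scaledKraft : ℕ → Code k → ℕ
  scaledKraft L C = ∑ (λ w → suc k ^ (L ∸ length w)) C

  infix 7 _/r^_
  _/r^_ : ℕ → ℕ → ℚ
  a /r^ L = ℤ.+ a ℚ./ suc k ^ L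
    where instance _ = ℕₚ.m^n≢0 (suc k) L

  kraft≡scaledKraft/r^ : ∀ {L} (C : Code k) → LengthsAtMost L C → kraft C ≡ scaledKraft L C /r^ L
  kraft≡scaledKraft/r^ {L} [] [] = sym (ℚₚ.0/n≡0 (suc k ^ L))
    where instance _ = ℕₚ.m^n≢0 (suc k) L
  kraft≡scaledKraft/r^ {L} (w ∷ C) (w≤L ∷ C≤L) = begin
    1 /r^ length w ℚ.+ kraft C
      ≡⟨ cong₂ ℚ._+_ (/-cross 1 (r ^ (L ∸ length w)) (r ^ length w) (r ^ L) r^L≡r^[L∸|w|]*r^|w|)
                     (kraft≡scaledKraft/r^ C C≤L) ⟩
    r ^ (L ∸ length w) /r^ L ℚ.+ scaledKraft L C /r^ L
      ≡⟨ +-/ (r ^ (L ∸ length w)) (scaledKraft L C) (r ^ L) ⟩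
    scaledKraft L (w ∷ C) /r^ L ∎
    where
    open ≡-Reasoning
    r = suc k
    instance
      _ = ℕₚ.m^n≢0 r L
      _ = ℕₚ.m^n≢0 r (length w)
    r^L≡r^[L∸|w|]*r^|w| : 1 * r ^ L ≡ r ^ (L ∸ length w) * r ^ length w
    r^L≡r^[L∸|w|]*r^|w| = begin
      1 * r ^ L                           ≡⟨ ℕₚ.*-identityˡ (r ^ L) ⟩
      r ^ L                               ≡⟨ cong (r ^_) (ℕₚ.m∸n+n≡m w≤L) ⟨
      r ^ (L ∸ length w + length w)       ≡⟨ ℕₚ.^-distribˡ-+-* r (L ∸ length w) (length w) ⟩
      r ^ (L ∸ length w) * r ^ length w   ∎

  scaledKraft-cong : ∀ {L} {C D : Code k} → LengthsAtMost L C → LengthsAtMost L D →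
                     kraft C ≡ kraft D → scaledKraft L C ≡ scaledKraft L D
  scaledKraft-cong {L} {C} {D} C≤L D≤L K[C]≡K[D] = /-injectiveˡ (suc k ^ L) {{ℕₚ.m^n≢0 (suc k) L}}
    (trans (sym (kraft≡scaledKraft/r^ C C≤L)) (trans K[C]≡K[D] (kraft≡scaledKraft/r^ D D≤L)))

  concatWeight : ℕ → List (Word k) → ℕ
  concatWeight N t = suc k ^ (N ∸ length (concat t))

  ∑-concatWeight-tuples : ∀ {L X} → LengthsAtMost L X → ∀ n {N} → n * L ≤ N →
                          ∑ (concatWeight N) (tuples n X) ≡ suc k ^ (N ∸ n * L) * scaledKraft L X ^ n
  ∑-concatWeight-tuples {L} {X} X≤L zero {N} _ = trans (ℕₚ.+-identityʳ _) (sym (ℕₚ.*-identityʳ _))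
  ∑-concatWeight-tuples {L} {X} X≤L (suc n) {N} L+nL≤N = begin
    ∑ (concatWeight N) (cartesianProductWith _∷_ X (tuples n X))
      ≡⟨ ∑-cartesianProductWith (concatWeight N) _∷_ X (tuples n X) ⟩
    ∑ (λ x → ∑ (λ t → concatWeight N (x ∷ t)) (tuples n X)) X
      ≡⟨ ∑-cong X (λ {x} x∈X → trans (∑-cong (tuples n X) (split x∈X))
                                  (∑-*ˡ (concatWeight (N ∸ L)) (r ^ (L ∸ length x)) (tuples n X))) ⟩
    ∑ (λ x → r ^ (L ∸ length x) * ∑ (concatWeight (N ∸ L)) (tuples n X)) X
      ≡⟨ ∑-*ʳ (λ x → r ^ (L ∸ length x)) _ X ⟩
    S * ∑ (concatWeight (N ∸ L)) (tuples n X)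
      ≡⟨ cong (S *_) (∑-concatWeight-tuples X≤L n nL≤N∸L) ⟩
    S * (r ^ (N ∸ L ∸ n * L) * S ^ n)
      ≡⟨ cong (λ e → S * (r ^ e * S ^ n)) (ℕₚ.∸-+-assoc N L (n * L)) ⟩
    S * (r ^ (N ∸ (L + n * L)) * S ^ n)
      ≡⟨ x∙yz≈y∙xz S (r ^ (N ∸ (L + n * L))) (S ^ n) ⟩
    r ^ (N ∸ (L + n * L)) * (S * S ^ n) ∎
    where
    open ≡-Reasoning
    r = suc k
    S = scaledKraft L X
    nL≤N∸L : n * L ≤ N ∸ L
    nL≤N∸L = ℕₚ.m+n≤o⇒m≤o∸n (n * L) (subst (_≤ N) (ℕₚ.+-comm L (n * L)) L+nL≤N)
    split : ∀ {x t} → x ∈ X → t ∈ tuples n X →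
            concatWeight N (x ∷ t) ≡ r ^ (L ∸ length x) * concatWeight (N ∸ L) t
    split {x} {t} x∈X t∈ = begin
      r ^ (N ∸ length (x ++ concat t))                  ≡⟨ cong (λ l → r ^ (N ∸ l)) (Listₚ.length-++ x) ⟩
      r ^ (N ∸ (length x + length (concat t)))          ≡⟨ cong (r ^_) (m∸[n+o]≡[p∸n]+[m∸p∸o]
                                                             (All.lookup X≤L x∈X) (ℕₚ.≤-trans (ℕₚ.m≤m+n L _) L+nL≤N)
                                                             (ℕₚ.≤-trans |t|≤nL nL≤N∸L)) ⟩
      r ^ ((L ∸ length x) + (N ∸ L ∸ length (concat t))) ≡⟨ ℕₚ.^-distribˡ-+-* r (L ∸ length x) _ ⟩
      r ^ (L ∸ length x) * concatWeight (N ∸ L) t       ∎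
      where
      |t|≤nL : length (concat t) ≤ n * L
      |t|≤nL = let |t|≡n , t⊆X = ∈-tuples⁻ n X t∈ in
        subst (λ l → length (concat t) ≤ l * L) |t|≡n (length-concat≤ L t (All.map (All.lookup X≤L) t⊆X))

  -- Under the Kraft inequality K(X) ≤ 1 the block sums K(X)^m decrease with m, so each of
  -- the c blocks of tuplesBetween is dominated by the first one.
  ∑-concatWeight-tuplesBetween≤ : ∀ {L X} → LengthsAtMost L X → scaledKraft L X ≤ suc k ^ L →
    ∀ a c {N} → (a + c) * L ≤ N →
    ∑ (concatWeight N) (tuplesBetween a c X) ≤ c * (suc k ^ (N ∸ a * L) * scaledKraft L X ^ a)
  ∑-concatWeight-tuplesBetween≤ X≤L X-kraft a zero _ = z≤n
  ∑-concatWeight-tuplesBetween≤ {L} {X} X≤L X-kraft a (suc c) {N} [a+1+c]L≤N = begin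
    ∑ (concatWeight N) (tuples a X ++ tuplesBetween (suc a) c X)
      ≡⟨ ∑-++ (concatWeight N) (tuples a X) _ ⟩
    ∑ (concatWeight N) (tuples a X) + ∑ (concatWeight N) (tuplesBetween (suc a) c X)
      ≤⟨ ℕₚ.+-mono-≤ (ℕₚ.≤-reflexive (∑-concatWeight-tuples X≤L a aL≤N))
                     (∑-concatWeight-tuplesBetween≤ X≤L X-kraft (suc a) c [a+1+c]L≤N′) ⟩
    T a + c * T (suc a)
      ≤⟨ ℕₚ.+-monoʳ-≤ (T a) (ℕₚ.*-monoʳ-≤ c T-decreasing) ⟩
    T a + c * T a ∎
    where
    open ℕₚ.≤-Reasoning
    r = suc k
    S = scaledKraft L X
    T : ℕ → ℕ
    T m = r ^ (N ∸ m * L) * S ^ m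
    [a+1+c]L≤N′ : (suc a + c) * L ≤ N
    [a+1+c]L≤N′ = subst (λ x → x * L ≤ N) (ℕₚ.+-suc a c) [a+1+c]L≤N
    [1+a]L≤N : L + a * L ≤ N
    [1+a]L≤N = ℕₚ.≤-trans (ℕₚ.*-monoˡ-≤ L (ℕₚ.m≤m+n (suc a) c)) [a+1+c]L≤N′
    aL≤N : a * L ≤ N
    aL≤N = ℕₚ.≤-trans (ℕₚ.m≤n+m (a * L) L) [1+a]L≤N
    T-decreasing : T (suc a) ≤ T a
    T-decreasing = begin
      r ^ (N ∸ (L + a * L)) * (S * S ^ a)        ≤⟨ ℕₚ.*-monoʳ-≤ (r ^ (N ∸ (L + a * L))) (ℕₚ.*-monoˡ-≤ (S ^ a) X-kraft) ⟩
      r ^ (N ∸ (L + a * L)) * (r ^ L * S ^ a)    ≡⟨ ℕₚ.*-assoc (r ^ (N ∸ (L + a * L))) (r ^ L) (S ^ a) ⟨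
      r ^ (N ∸ (L + a * L)) * r ^ L * S ^ a      ≡⟨ cong (_* S ^ a) (ℕₚ.^-distribˡ-+-* r (N ∸ (L + a * L)) L) ⟨
      r ^ (N ∸ (L + a * L) + L) * S ^ a          ≡⟨ cong (λ e → r ^ e * S ^ a) (m∸[n+o]+n≡m∸o {N} {L} {a * L} [1+a]L≤N) ⟩
      T a                                        ∎

  module _ {C D : Code k} (C≼D : C ≼ D) where

    -- The value on words outside C is irrelevant.
    factors : Word k → List (Word k)
    factors w with w ∈? C
    ... | yes w∈C = proj₁ (All.lookup C≼D w∈C)
    ... | no _ = [ w ]

    factors-factorise : ∀ {w} → w ∈ C → All (_∈ D) (factors w) × concat (factors w) ≡ w
    factors-factorise {w} w∈C with w ∈? C
    ... | yes w∈C′ = proj₂ (All.lookup C≼D w∈C′)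
    ... | no w∉C = ⊥-elim (w∉C w∈C)

    refine : List (Word k) → List (Word k)
    refine = concatMap factors

    concat-refine : ∀ {t} → All (_∈ C) t → concat (refine t) ≡ concat t
    concat-refine [] = refl
    concat-refine {w ∷ t} (w∈C ∷ t⊆C) = trans (sym (Listₚ.concat-++ (factors w) (refine t)))
      (cong₂ _++_ (proj₂ (factors-factorise w∈C)) (concat-refine t⊆C))

    refine-⊆ : ∀ {t} → All (_∈ C) t → All (_∈ D) (refine t)
    refine-⊆ t⊆C = AllP.concat⁺ (AllP.map⁺ (All.map (proj₁ ∘ factors-factorise) t⊆C))

    length≤length-refine : ¬ ([] ∈ C) → ∀ {t} → All (_∈ C) t → length t ≤ length (refine t)
    length≤length-refine []∉C {t} t⊆C = subst (_≤ length (refine t)) (Listₚ.length-map factors t)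
      (length≤length-concat (map factors t) (AllP.map⁺ (All.map factors≢[] t⊆C)))
      where
      factors≢[] : ∀ {w} → w ∈ C → factors w ≢ []
      factors≢[] w∈C factors≡[] =
        []∉C (subst (_∈ C) (trans (sym (proj₂ (factors-factorise w∈C))) (cong concat factors≡[])) w∈C)

    length-refine≤ : ¬ ([] ∈ D) → ∀ {t} → All (_∈ C) t → length (refine t) ≤ length (concat t)
    length-refine≤ []∉D {t} t⊆C = subst (length (refine t) ≤_) (cong length (concat-refine t⊆C))
      (length≤length-concat (refine t) (∉⇒All≢[] []∉D (refine-⊆ t⊆C)))

  -- Refining a string of n words of C over D is injective (C is UD) and lands in the
  -- D-strings of length in [n, nL], so K(C)^n ≤ (1 + nL) K(D)^n for every n.
  scaledKraft-mono-≼ : ∀ {C D L} → IsUDCode C → ¬ ([] ∈ D) → C ≼ D →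
                       LengthsAtMost L C → LengthsAtMost L D → scaledKraft L D ≤ suc k ^ L →
                       scaledKraft L C ≤ scaledKraft L D
  scaledKraft-mono-≼ {C} {D} {L} (([]∉C , C!) , C-ud) []∉D C≼D C≤L D≤L D-kraft =
    ≤-if-^≤linear*^ (scaledKraft L C) (scaledKraft L D) L power-bound
    where
    r = suc k
    power-bound : ∀ n → scaledKraft L C ^ n ≤ suc (n * L) * scaledKraft L D ^ n
    power-bound n = ℕₚ.*-cancelˡ-≤ (r ^ (N ∸ n * L)) {{ℕₚ.m^n≢0 r (N ∸ n * L)}} (begin
      r ^ (N ∸ n * L) * scaledKraft L C ^ n           ≡⟨ ∑-concatWeight-tuples C≤L n nL≤N ⟨
      ∑ (concatWeight N) (tuples n C)                 ≡⟨ ∑-cong (tuples n C) (λ t∈ → cong (λ u → r ^ (N ∸ length u))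
                                                          (sym (concat-refine C≼D (proj₂ (∈-tuples⁻ n C t∈))))) ⟩
      ∑ (concatWeight N ∘ refine C≼D) (tuples n C)    ≤⟨ ∑-≤-injection (concatWeight N) (refine C≼D)
                                                          (tuples-unique n C!) refine-injective refine-between ⟩
      ∑ (concatWeight N) (tuplesBetween n c D)        ≤⟨ ∑-concatWeight-tuplesBetween≤ D≤L D-kraft n c ℕₚ.≤-refl ⟩
      c * (r ^ (N ∸ n * L) * scaledKraft L D ^ n)     ≡⟨ x∙yz≈y∙xz c (r ^ (N ∸ n * L)) _ ⟩
      r ^ (N ∸ n * L) * (c * scaledKraft L D ^ n)     ∎)
      where
      open ℕₚ.≤-Reasoning
      c = suc (n * L)
      N = (n + c) * L
      nL≤N : n * L ≤ N
      nL≤N = ℕₚ.*-monoˡ-≤ L (ℕₚ.m≤m+n n c)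
      refine-injective : ∀ {s t} → s ∈ tuples n C → t ∈ tuples n C → refine C≼D s ≡ refine C≼D t → s ≡ t
      refine-injective s∈ t∈ eq = C-ud _ _ (proj₂ (∈-tuples⁻ n C s∈)) (proj₂ (∈-tuples⁻ n C t∈))
        (trans (sym (concat-refine C≼D (proj₂ (∈-tuples⁻ n C s∈))))
               (trans (cong concat eq) (concat-refine C≼D (proj₂ (∈-tuples⁻ n C t∈)))))
      refine-between : ∀ {t} → t ∈ tuples n C → refine C≼D t ∈ tuplesBetween n c D
      refine-between {t} t∈ = ∈-tuplesBetween⁺ n c D
        (subst (_≤ length (refine C≼D t)) |t|≡n (length≤length-refine C≼D []∉C t⊆C))
        (subst (length (refine C≼D t) <_) (sym (ℕₚ.+-suc n (n * L)))
          (s≤s (ℕₚ.≤-trans (length-refine≤ C≼D []∉D t⊆C) (ℕₚ.≤-trans |concat-t|≤nL (ℕₚ.m≤n+m (n * L) n)))))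
        (refine-⊆ C≼D t⊆C)
        where
        |t|≡n = proj₁ (∈-tuples⁻ n C t∈)
        t⊆C = proj₂ (∈-tuples⁻ n C t∈)
        |concat-t|≤nL : length (concat t) ≤ n * L
        |concat-t|≤nL = subst (λ l → length (concat t) ≤ l * L) |t|≡n
                          (length-concat≤ L t (All.map (All.lookup C≤L) t⊆C))

  alphabet : Code k
  alphabet = map [_] (allFin (suc k))

  ≼-alphabet : ∀ C → C ≼ alphabet
  ≼-alphabet C = All.universal (λ w → map [_] w , letters w , Listₚ.concat-map-[ w ]) C
    where
    letters : ∀ w → All (_∈ alphabet) (map [_] w)
    letters w = AllP.map⁺ (All.universal (λ a → ∈-map⁺ [_] (∈-allFin a)) w)

  []∉alphabet : ¬ ([] ∈ alphabet)
  []∉alphabet []∈ with ∈-map⁻ [_] []∈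
  ... | _ , _ , ()

  scaledKraft[1+L]-alphabet : ∀ L → scaledKraft (suc L) alphabet ≡ suc k ^ suc L
  scaledKraft[1+L]-alphabet L = begin
    scaledKraft (suc L) (map [_] (allFin (suc k)))  ≡⟨ ∑-map (λ w → suc k ^ (suc L ∸ length w)) [_] (allFin (suc k)) ⟩
    ∑ (λ _ → suc k ^ L) (allFin (suc k))             ≡⟨ ∑-const (suc k ^ L) (allFin (suc k)) ⟩
    length (allFin (suc k)) * suc k ^ L              ≡⟨ cong (_* suc k ^ L) (Listₚ.length-tabulate {n = suc k} (λ i → i)) ⟩
    suc k ^ suc L                                    ∎
    where open ≡-Reasoning

  scaledKraft-suc : ∀ {L C} → LengthsAtMost L C → scaledKraft (suc L) C ≡ suc k * scaledKraft L C
  scaledKraft-suc {L} {C} C≤L = trans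
    (∑-cong C (λ w∈C → cong (suc k ^_) (ℕₚ.+-∸-assoc 1 (All.lookup C≤L w∈C))))
    (∑-*ˡ (λ w → suc k ^ (L ∸ length w)) (suc k) C)

  -- McMillan's inequality K(D) ≤ 1, as the comparison of D with the alphabet.
  mcmillan : ∀ {D L} → IsUDCode D → LengthsAtMost L D → scaledKraft L D ≤ suc k ^ L
  mcmillan {D} {L} D-ud D≤L = ℕₚ.*-cancelˡ-≤ (suc k) (begin
    suc k * scaledKraft L D        ≡⟨ scaledKraft-suc D≤L ⟨
    scaledKraft (suc L) D          ≤⟨ scaledKraft-mono-≼ D-ud []∉alphabet (≼-alphabet D)
                                        (All.map ℕₚ.m≤n⇒m≤1+n D≤L) alphabet≤1+L
                                        (ℕₚ.≤-reflexive (scaledKraft[1+L]-alphabet L)) ⟩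
    scaledKraft (suc L) alphabet   ≡⟨ scaledKraft[1+L]-alphabet L ⟩
    suc k ^ suc L                  ∎)
    where
    open ℕₚ.≤-Reasoning
    alphabet≤1+L : LengthsAtMost (suc L) alphabet
    alphabet≤1+L = AllP.map⁺ (All.universal (λ _ → s≤s z≤n) (allFin (suc k)))

  shortWords : ℕ → Code k → Code k
  shortWords L = filter (λ w → length w ≤? L)

  shortWords-UD : ∀ {L} {D : Code k} → IsUDCode D → IsUDCode (shortWords L D)
  shortWords-UD {L} {D} (([]∉D , D!) , D-ud) =
    ((λ []∈ → []∉D (⊆D []∈)) , UniqueP.filter⁺ (λ w → length w ≤? L) D!) ,
    λ xs ys xs⊆ ys⊆ → D-ud xs ys (All.map ⊆D xs⊆) (All.map ⊆D ys⊆)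
    where
    ⊆D : ∀ {w} → w ∈ shortWords L D → w ∈ D
    ⊆D = proj₁ ∘ ∈-filter⁻ (λ w → length w ≤? L)

  -- A factor is never longer than the word it factorises.
  ≼-shortWords : ∀ {L} {C D : Code k} → C ≼ D → LengthsAtMost L C → C ≼ shortWords L D
  ≼-shortWords {L} C≼D C≤L = All.zipWith (λ ((ws , ws⊆D , ws≡w) , |w|≤L) →
    ws , All.tabulate (λ {v} v∈ws → ∈-filter⁺ (λ w → length w ≤? L) (All.lookup ws⊆D v∈ws)
           (ℕₚ.≤-trans (length-∈-concat v∈ws) (subst (λ u → length u ≤ L) (sym ws≡w) |w|≤L)))
       , ws≡w)
    (C≼D , C≤L)

  -- Dropping from D its words longer than every word of C keeps D finer than C, and
  -- K(C) ≤ K(shortWords) ≤ K(D) = K(C) forces nothing to have been dropped.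
  ≼∧kraft≡⇒LengthsAtMost-maxLength : ∀ {C D : Code k} → IsUDCode C → IsUDCode D → C ≼ D →
                                      kraft C ≡ kraft D → LengthsAtMost (maxLength C) D
  ≼∧kraft≡⇒LengthsAtMost-maxLength {C} {D} C-ud D-ud C≼D K[C]≡K[D] = All.tabulate short
    where
    Lᶜ = maxLength C
    L = Lᶜ ⊔ maxLength D
    C≤L = LengthsAtMost-mono (ℕₚ.m≤m⊔n Lᶜ (maxLength D)) (LengthsAtMost-maxLength C)
    D≤L = LengthsAtMost-mono (ℕₚ.m≤n⊔m Lᶜ (maxLength D)) (LengthsAtMost-maxLength D)
    D′ = shortWords Lᶜ D
    D′≤L : LengthsAtMost L D′
    D′≤L = All.tabulate (λ w∈D′ → All.lookup D≤L (proj₁ (∈-filter⁻ (λ w → length w ≤? Lᶜ) w∈D′)))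
    K[C]≤K[D′] : scaledKraft L C ≤ scaledKraft L D′
    K[C]≤K[D′] = scaledKraft-mono-≼ C-ud (proj₁ (proj₁ (shortWords-UD D-ud)))
      (≼-shortWords C≼D (LengthsAtMost-maxLength C)) C≤L D′≤L (mcmillan (shortWords-UD D-ud) D′≤L)
    short : ∀ {d} → d ∈ D → length d ≤ Lᶜ
    short {d} d∈D with length d ≤? Lᶜ
    ... | yes |d|≤Lᶜ = |d|≤Lᶜ
    ... | no |d|≰Lᶜ = contradiction
      (ℕₚ.≤-trans (ℕₚ.≤-reflexive (scaledKraft-cong D≤L C≤L (sym K[C]≡K[D]))) K[C]≤K[D′])
      (ℕₚ.<⇒≱ (∑-filter-< (λ w → suc k ^ (L ∸ length w)) (λ w → length w ≤? Lᶜ) d∈D |d|≰Lᶜ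
                 (ℕₚ.m^n>0 (suc k) (L ∸ length d))))

  boundedCodes : ℕ → List (Code k)
  boundedCodes L = sublists (tuplesBetween 0 (suc L) (allFin (suc k)))

  -- As a set, D is the filter of the list of all words of length at most L by membership in D.
  ∈-boundedCodes : ∀ {L} (D : Code k) → LengthsAtMost L D → Any (D ≈C_) (boundedCodes L)
  ∈-boundedCodes {L} D D≤L = Any.map (λ { refl w → mk⇔ (λ w∈D → ∈-filter⁺ (_∈? D) (∈-words w∈D) w∈D)
                                                        (proj₂ ∘ ∈-filter⁻ (_∈? D)) })
                                      (filter∈sublists (_∈? D) (tuplesBetween 0 (suc L) (allFin (suc k))))
    where
    ∈-words : ∀ {w} → w ∈ D → w ∈ tuplesBetween 0 (suc L) (allFin (suc k))
    ∈-words w∈D = ∈-tuplesBetween⁺ 0 (suc L) (allFin (suc k)) z≤n (s≤s (All.lookup D≤L w∈D))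
                    (All.universal ∈-allFin _)

-- Chains with finite upsets

module _ (𝒫 : Preorder 0ℓ 0ℓ 0ℓ) where

  open Preorder 𝒫 renaming (refl to ≲-refl; trans to ≲-trans)

  FinitelyMany : (Carrier → Set) → Set
  FinitelyMany Q = ∃ λ xs → ∀ y → Q y → Any (y ≈_) xs

  module _ (em : ExcludedMiddle 0ℓ) {P : Carrier → Set}
    (P-chain : ∀ x y → P x → P y → x ≲ y ⊎ y ≲ x)
    (P-antisym : ∀ {x y} → P x → P y → x ≲ y → y ≲ x → x ≈ y)
    (P-upsets-finite : ∀ x → P x → FinitelyMany (λ y → P y × x ≲ y))
    (P-infinite : ¬ FinitelyMany P)
    where

    Greatest : (Carrier → Set) → Carrier → Set
    Greatest Q M = P M × Q M × (∀ y → P y → Q y → y ≲ M)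

    witnesses : ∀ (Q : Carrier → Set) xs → ∃ λ ms → All (λ m → P m × Q m) ms ×
                (∀ y → P y → Q y → Any (y ≈_) xs → Any (y ≈_) ms)
    witnesses Q [] = [] , [] , λ _ _ _ ()
    witnesses Q (x ∷ xs) with witnesses Q xs | em {∃ λ m → P m × Q m × m ≈ x}
    ... | ms , ms⊆PQ , covers | yes (m , Pm , Qm , m≈x) =
      m ∷ ms , (Pm , Qm) ∷ ms⊆PQ , λ where
        y Py Qy (here y≈x) → here (Eq.trans y≈x (Eq.sym m≈x))
        y Py Qy (there y∈xs) → there (covers y Py Qy y∈xs)
    ... | ms , ms⊆PQ , covers | no ∄m =
      ms , ms⊆PQ , λ where
        y Py Qy (here y≈x) → ⊥-elim (∄m (y , Py , Qy , y≈x))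
        y Py Qy (there y∈xs) → covers y Py Qy y∈xs

    maximum : ∀ {Q : Carrier → Set} x → P x → Q x → ∀ ms → All (λ m → P m × Q m) ms →
              ∃ λ M → P M × Q M × x ≲ M × All (_≲ M) ms
    maximum x Px Qx [] [] = x , Px , Qx , ≲-refl , []
    maximum x Px Qx (m ∷ ms) ((Pm , Qm) ∷ ms⊆PQ) with P-chain m x Pm Px
    ... | inj₁ m≲x = let M , PM , QM , x≲M , ms≲M = maximum x Px Qx ms ms⊆PQ in
                     M , PM , QM , x≲M , ≲-trans m≲x x≲M ∷ ms≲M
    ... | inj₂ x≲m = let M , PM , QM , m≲M , ms≲M = maximum m Pm Qm ms ms⊆PQ in
                     M , PM , QM , ≲-trans x≲m m≲M , m≲M ∷ ms≲M

    -- Above any x ∈ P ∩ Q there are only finitely many elements, so P ∩ Q has a greatest element.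
    greatest : ∀ Q x → P x → Q x → ∃ (Greatest Q)
    greatest Q x Px Qx =
      let xs , above-x = P-upsets-finite x Px
          ms , ms⊆PQ , covers = witnesses Q xs
          M , PM , QM , x≲M , ms≲M = maximum x Px Qx ms ms⊆PQ
      in M , PM , QM , λ y Py Qy → bounded y Py Qy x≲M ms≲M (λ x≲y → covers y Py Qy (above-x y (Py , x≲y)))
      where
      bounded : ∀ y → P y → Q y → ∀ {M ms} → x ≲ M → All (_≲ M) ms → (x ≲ y → Any (y ≈_) ms) → y ≲ M
      bounded y Py Qy x≲M ms≲M y∈ms with P-chain y x Py Px
      ... | inj₁ y≲x = ≲-trans y≲x x≲M
      ... | inj₂ x≲y = Any-≲ (y∈ms x≲y) ms≲M
        where
        Any-≲ : ∀ {M ms} → Any (y ≈_) ms → All (_≲ M) ms → y ≲ M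
        Any-≲ (here y≈m) (m≲M ∷ _) = ≲-trans (reflexive y≈m) m≲M
        Any-≲ (there y∈ms) (_ ∷ ms≲M) = Any-≲ y∈ms ms≲M

    P-nonempty : ∃ P
    P-nonempty = em⇒dne em λ ∄x → P-infinite ([] , λ x Px → ⊥-elim (∄x (x , Px)))

    top : ∃ (Greatest (λ _ → ⊤))
    top = let x , Px = P-nonempty in greatest (λ _ → ⊤) x Px tt

    next : ∀ x → P x → ∃ (Greatest (λ y → ¬ x ≲ y))
    next x Px = let y , Py , x⋦y = em⇒dne em not-all-above in greatest (λ y → ¬ x ≲ y) y Py x⋦y
      where
      not-all-above : ¬ ¬ ∃ λ y → P y × ¬ x ≲ y
      not-all-above ∄y = let xs , above-x = P-upsets-finite x Px in
        P-infinite (xs , λ y Py → above-x y (Py , em⇒dne em λ x⋦y → ∄y (y , Py , x⋦y)))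

    enum : ℕ → ∃ P
    enum zero = let M , PM , _ = top in M , PM
    enum (suc n) = let M , PM , _ = next (proj₁ (enum n)) (proj₂ (enum n)) in M , PM

    f : ℕ → Carrier
    f n = proj₁ (enum n)

    P-f : ∀ n → P (f n)
    P-f n = proj₂ (enum n)

    f[n]⋦f[1+n] : ∀ n → ¬ f n ≲ f (suc n)
    f[n]⋦f[1+n] n = proj₁ (proj₂ (proj₂ (next (f n) (P-f n))))

    next-greatest : ∀ n y → P y → ¬ f n ≲ y → y ≲ f (suc n)
    next-greatest n = proj₂ (proj₂ (proj₂ (next (f n) (P-f n))))

    f-step : ∀ n → f (suc n) ≲ f n
    f-step n with P-chain (f (suc n)) (f n) (P-f (suc n)) (P-f n)
    ... | inj₁ f[1+n]≲f[n] = f[1+n]≲f[n]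
    ... | inj₂ f[n]≲f[1+n] = contradiction f[n]≲f[1+n] (f[n]⋦f[1+n] n)

    f-antitone : ∀ {m n} → m ≤ n → f n ≲ f m
    f-antitone {n = zero} z≤n = ≲-refl
    f-antitone {n = suc n} m≤1+n with ℕₚ.m≤n⇒m<n∨m≡n m≤1+n
    ... | inj₁ (s≤s m≤n) = ≲-trans (f-step n) (f-antitone m≤n)
    ... | inj₂ refl = ≲-refl

    f-reflects : ∀ {m n} → f n ≲ f m → m ≤ n
    f-reflects {m} {n} f[n]≲f[m] with m ≤? n
    ... | yes m≤n = m≤n
    ... | no m≰n = contradiction (≲-trans f[n]≲f[m] (f-antitone (ℕₚ.≰⇒> m≰n))) (f[n]⋦f[1+n] n)

    -- The f n, being pairwise inequivalent, cannot all lie in the finite upset of x.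
    f-not-all-above : ∀ x → P x → ¬ (∀ n → x ≲ f n)
    f-not-all-above x Px x≲f = ℕₚ.<⇒≢ i<j (ℕₚ.≤-antisym (ℕₚ.<⇒≤ i<j) (f-reflects f[i]≲f[j]))
      where
      xs = proj₁ (P-upsets-finite x Px)
      f∈xs : ∀ n → Any (f n ≈_) xs
      f∈xs n = proj₂ (P-upsets-finite x Px) (f n) (P-f n , x≲f n)
      index : Fin.Fin (suc (length xs)) → Fin.Fin (length xs)
      index i = Any.index (f∈xs (Fin.toℕ i))
      collision = Finₚ.pigeonhole (ℕₚ.n<1+n (length xs)) index
      i = Fin.toℕ (proj₁ collision)
      j = Fin.toℕ (proj₁ (proj₂ collision))
      i<j : i < j
      i<j = proj₁ (proj₂ (proj₂ collision))
      f[i]≲f[j] : f i ≲ f j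
      f[i]≲f[j] = ≲-trans (reflexive (lookup-index (f∈xs i))) (reflexive (Eq.sym f[j]≈))
        where
        f[j]≈ : f j ≈ lookup xs (index (proj₁ collision))
        f[j]≈ = subst (λ p → f j ≈ lookup xs p) (sym (proj₂ (proj₂ (proj₂ collision)))) (lookup-index (f∈xs j))

    ≈-f-below : ∀ x → P x → ∀ n → ¬ x ≲ f n → ∃ λ m → x ≈ f m
    ≈-f-below x Px zero x⋦top = ⊥-elim (x⋦top (proj₂ (proj₂ (proj₂ top)) x Px tt))
    ≈-f-below x Px (suc n) x⋦f[1+n] with em {x ≲ f n}
    ... | no x⋦f[n] = ≈-f-below x Px n x⋦f[n]
    ... | yes x≲f[n] with em {f n ≲ x}
    ...   | yes f[n]≲x = n , P-antisym Px (P-f n) x≲f[n] f[n]≲x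
    ...   | no f[n]⋦x = ⊥-elim (x⋦f[1+n] (next-greatest n x Px f[n]⋦x))

    ≈-f : ∀ x → P x → ∃ λ m → x ≈ f m
    ≈-f x Px = let n , x⋦f[n] = em⇒dne em λ ∄n → f-not-all-above x Px (λ n → em⇒dne em λ x⋦ → ∄n (n , x⋦)) in
               ≈-f-below x Px n x⋦f[n]

    omega-star : ∃ λ (f : ℕ → Carrier) → (∀ n → P (f n)) ×
                 (∀ m n → (m ≤ n) ⇔ (f n ≲ f m)) × (∀ x → P x → ∃ λ n → x ≈ f n)
    omega-star = f , P-f , (λ m n → mk⇔ f-antitone f-reflects) , ≈-f

proposition3 : ExcludedMiddle 0ℓ →
    (k : ℕ) (P : Code k → Set) →
    (∀ C → P C → IsUDCode C) →
    IsChain P →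
    Infinite P →
    (∀ C D → P C → P D → kraft C ≡ kraft D) →
    HasOrderTypeOmegaStar P
proposition3 em k P P-UD P-chain P-infinite P-kraft =
  omega-star ≼-preorder em P-chain P-antisym upsets-finite P-infinite
  where
  P-antisym : ∀ {C D} → P C → P D → C ≼ D → D ≼ C → C ≈C D
  P-antisym {C} {D} PC PD = ≼-antisym (P-UD C PC) (P-UD D PD)

  upsets-finite : ∀ C → P C → FinitelyMany ≼-preorder (λ D → P D × C ≼ D)
  upsets-finite C PC = boundedCodes (maxLength C) , λ D (PD , C≼D) →
    ∈-boundedCodes D (≼∧kraft≡⇒LengthsAtMost-maxLength (P-UD C PC) (P-UD D PD) C≼D (P-kraft C D PC PD))
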